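{- Let $G=(V,E)$ be an undirected unweighted graph and $P\subseteq V\times V$ a set of node pairs, and let $G'=((V_1,V_2),E'),P'$ be the bipartite preserver lift of $G,P$. If $H'$ is a pairwise distance preserver of $G',P'$, then the contraction $H$ of $H'$ is a pairwise distance preserver of $G,P$.
   Context: A pairwise distance preserver of $G,P$ is a subgraph $H\subseteq G$ with $\mathrm{dist}_H(u,v)=\mathrm{dist}_G(u,v)$ for all $(u,v)\in P$. The bipartite preserver lift of $G,P$ is the bipartite graph $G'$ with two copies $V_1,V_2$ of $V$ (node $x\in V$ has copies $x_1\in V_1$, $x_2\in V_2$), with edges $(u_1,v_2)$ and $(u_2,v_1)$ for each edge $(u,v)\in E$, and pair set $P'$ containing, for each $(s,t)\in P$, the pairs $(s_1,t_1),(s_2,t_2)$ if $\mathrm{dist}_G(s,t)$ is even and the pairs $(s_1,t_2),(s_2,t_1)$ if $\mathrm{dist}_G(s,t)$ is odd. For a subgraph $H'=(V_1\cup V_2,E'_H)\subseteq G'$, its contraction is the graph $H=(V,E_H)$ with $E_H=\{(u,v)\in V\times V: (u_1,v_2)\in E'_H \text{ or } (u_2,v_1)\in E'_H\}$. -}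

module Defs where

open import Data.Nat using (ℕ; zero; suc; _≤_)
open import Data.Bool using (Bool; true; false; _xor_)
open import Data.Product using (Σ; _×_; _,_)
open import Data.Sum using (_⊎_)
open import Relation.Binary.PropositionalEquality using (_≡_)

record Graph (V : Set) : Set₁ where
  field
    Adj : V → V → Set
    sym : ∀ {u v} → Adj u v → Adj v u
open Graph public

data Walk {V : Set} (E : V → V → Set) : V → V → ℕ → Set where
  nil  : ∀ {u} → Walk E u u 0
  cons : ∀ {u w v k} → E u w → Walk E w v k → Walk E u v (suc k)

-- dist_E(u,v) = d  (d finite; "no such d" means distance ∞)
IsDist : {V : Set} → (V → V → Set) → V → V → ℕ → Set
IsDist E u v d = Walk E u v d × (∀ k → Walk E u v k → d ≤ k)

IsSubgraph : {V : Set} → (F E : V → V → Set) → Set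
IsSubgraph F E = (∀ {u v} → F u v → F v u) × (∀ {u v} → F u v → E u v)

IsPreserver : {V : Set} → Graph V → (V → V → Set) → (V → V → Set) → Set
IsPreserver G P F =
  IsSubgraph F (Adj G) ×
  (∀ u v → P u v → ∀ d → (IsDist (Adj G) u v d → IsDist F u v d)
                        × (IsDist F u v d → IsDist (Adj G) u v d))

odd : ℕ → Bool
odd zero = false
odd (suc n) with odd n
... | true  = false
... | false = true

-- Bipartite lift: vertex (x , false) is x₁ ∈ V₁, (x , true) is x₂ ∈ V₂.
liftAdj : {V : Set} → Graph V → V × Bool → V × Bool → Set
liftAdj G (u , b) (v , c) = (b xor c ≡ true) × Adj G u v

liftGraph : {V : Set} → Graph V → Graph (V × Bool)
liftGraph G = record
  { Adj = liftAdj G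
  ; sym = λ { {u , false} {v , false} (() , _)
            ; {u , false} {v , true}  (p , e) → p , Graph.sym G e
            ; {u , true}  {v , false} (p , e) → p , Graph.sym G e
            ; {u , true}  {v , true}  (() , _) } }

liftPairs : {V : Set} → Graph V → (V → V → Set) → V × Bool → V × Bool → Set
liftPairs G P (s , b) (t , c) =
  P s t × Σ ℕ (λ d → IsDist (Adj G) s t d × (b xor c ≡ odd d))

contract : {V : Set} → (V × Bool → V × Bool → Set) → V → V → Set
contract F' u v = F' (u , false) (v , true) ⊎ F' (u , true) (v , false)

module Submission where

-- A walk u₀ u₁ … u_k in G lifts to the bipartite lift G', starting
-- at any copy (u₀ , b), by alternating sides; it ends at (u_k , b xor odd k).
-- Conversely every walk in G' (resp. in a subgraph H' of G') projects to a walk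
-- of the same length in G (resp. in the contraction H).  Hence, for (u,v) ∈ P
-- with dist_G(u,v) = d:
--   * a shortest u-v walk in G lifts to a shortest (u,0)-(v,odd d) walk in G',
--     and (u,0),(v,odd d) is a pair of P', so H' has a walk of length d between
--     them, which contracts to a u-v walk of length d in H;  since H ⊆ G no
--     shorter walk exists, so dist_H(u,v) = d.
--   * conversely, if dist_H(u,v) = d then d bounds below dist_G(u,v) by the
--     previous point, and hence (lemma lowerBound-from-minima) every u-v walk
--     in G; the H-walk is itself a G-walk, so dist_G(u,v) = d.

open import Data.Nat using (ℕ; suc; _≤_; _<_; _≤?_)
open import Data.Nat.Properties using (≤-trans; <⇒≤; ≰⇒>)
open import Data.Nat.Induction using (<-rec)
open import Data.Fin using (Fin)
open import Data.Bool using (Bool; true; false; not; _xor_)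
open import Data.Bool.Properties using (not-distribˡ-xor; not-distribʳ-xor)
open import Data.Product using (_×_; _,_; proj₁; proj₂)
open import Data.Sum using (inj₁; inj₂)
open import Data.Empty using (⊥-elim)
open import Relation.Nullary using (yes; no)
open import Relation.Binary.PropositionalEquality
  using (_≡_; refl; cong; subst; module ≡-Reasoning)
  renaming (sym to ≡-sym)
open import Defs

mapWalk : ∀ {A B : Set} {E : A → A → Set} {F : B → B → Set} (f : A → B) →
          (∀ {x y} → E x y → F (f x) (f y)) →
          ∀ {x y k} → Walk E x y k → Walk F (f x) (f y) k
mapWalk f edge nil        = nil
mapWalk f edge (cons e w) = cons (edge e) (mapWalk f edge w)

-- Parity flips at each step (odd is defined by 'with', so this is not definitional).
odd-suc : ∀ k → odd (suc k) ≡ not (odd k)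
odd-suc k with odd k
... | true  = refl
... | false = refl

-- Taking one more step of a walk started on the other side of the lift
-- preserves the endpoint parity  b xor odd k.
parity-step : ∀ b k → not b xor odd k ≡ b xor odd (suc k)
parity-step b k = begin
  not b xor odd k     ≡⟨ ≡-sym (not-distribˡ-xor b (odd k)) ⟩
  not (b xor odd k)   ≡⟨ not-distribʳ-xor b (odd k) ⟩
  b xor not (odd k)   ≡⟨ cong (b xor_) (≡-sym (odd-suc k)) ⟩
  b xor odd (suc k)   ∎
  where open ≡-Reasoning

module _ {V : Set} (G : Graph V) where

  liftEdge : ∀ {u w} b → Adj G u w → liftAdj G (u , b) (w , not b)
  liftEdge true  e = refl , e
  liftEdge false e = refl , e

  liftWalk : ∀ {u v k} b → Walk (Adj G) u v k →
             Walk (liftAdj G) (u , b) (v , b xor odd k) k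
  liftWalk true  nil = nil
  liftWalk false nil = nil
  liftWalk {v = v} {k = suc k} b (cons e w) =
    cons (liftEdge b e)
         (subst (λ c → Walk (liftAdj G) _ (v , c) k) (parity-step b k)
                (liftWalk (not b) w))

  projectWalk : ∀ {x y k} → Walk (liftAdj G) x y k → Walk (Adj G) (proj₁ x) (proj₁ y) k
  projectWalk = mapWalk proj₁ proj₂

  liftDist : ∀ {u v d} → IsDist (Adj G) u v d →
             IsDist (liftAdj G) (u , false) (v , odd d) d
  liftDist (w , shortest) = liftWalk false w , λ k w' → shortest k (projectWalk w')

-- Constructively this replaces "take a shortest walk", since the
-- existence of walks of a given length need not be decidable.
lowerBound-from-minima : (Q : ℕ → Set) (d : ℕ) →
                         (∀ k → Q k → (∀ j → Q j → k ≤ j) → d ≤ k) →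
                         ∀ k → Q k → d ≤ k
lowerBound-from-minima Q d atMinima = <-rec (λ k → Q k → d ≤ k) step
  where
  step : ∀ k → (∀ {j} → j < k → Q j → d ≤ j) → Q k → d ≤ k
  step k below qk with d ≤? k
  ... | yes d≤k = d≤k
  ... | no  d≰k = atMinima k qk minimal
    where
    -- below k nothing holds: such a j would give d ≤ j < k
    minimal : ∀ j → Q j → k ≤ j
    minimal j qj with k ≤? j
    ... | yes k≤j = k≤j
    ... | no  k≰j = ⊥-elim (d≰k (≤-trans (below (≰⇒> k≰j) qj) (<⇒≤ (≰⇒> k≰j))))

module Contraction {V : Set} (G : Graph V) (H' : V × Bool → V × Bool → Set)
                   (sub : IsSubgraph H' (liftAdj G)) where

  -- H' is bipartite, so each of its edges is an edge of the contraction.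
  contractEdge : ∀ {x y} → H' x y → contract H' (proj₁ x) (proj₁ y)
  contractEdge {_ , false} {_ , true}  h = inj₁ h
  contractEdge {_ , true}  {_ , false} h = inj₂ h
  contractEdge {_ , false} {_ , false} h with proj₁ (proj₂ sub h)
  ... | ()
  contractEdge {_ , true}  {_ , true}  h with proj₁ (proj₂ sub h)
  ... | ()

  contractWalk : ∀ {x y k} → Walk H' x y k → Walk (contract H') (proj₁ x) (proj₁ y) k
  contractWalk = mapWalk proj₁ contractEdge

  contractIsSubgraph : IsSubgraph (contract H') (Adj G)
  contractIsSubgraph = symmetric , inG
    where
    symmetric : ∀ {u v} → contract H' u v → contract H' v u
    symmetric (inj₁ h) = inj₂ (proj₁ sub h)
    symmetric (inj₂ h) = inj₁ (proj₁ sub h)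
    inG : ∀ {u v} → contract H' u v → Adj G u v
    inG (inj₁ h) = proj₂ (proj₂ sub h)
    inG (inj₂ h) = proj₂ (proj₂ sub h)

  toG : ∀ {u v k} → Walk (contract H') u v k → Walk (Adj G) u v k
  toG = mapWalk (λ x → x) (proj₂ contractIsSubgraph)

claim4 : (n : ℕ) (G : Graph (Fin n)) (P : Fin n → Fin n → Set)
         (H' : Fin n × Bool → Fin n × Bool → Set) →
         IsPreserver (liftGraph G) (liftPairs G P) H' →
         IsPreserver G P (contract H')
claim4 n G P H' (sub , preserves) =
  contractIsSubgraph , λ u v p d → forward u v p d , backward u v p d
  where
  open Contraction G H' sub

  walkInH : ∀ u v → P u v → ∀ d → IsDist (Adj G) u v d → Walk (contract H') u v d
  walkInH u v p d D =
    contractWalk (proj₁ (proj₁ (preserves (u , false) (v , odd d) (p , d , D , refl) d) (liftDist G D)))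

  forward : ∀ u v → P u v → ∀ d → IsDist (Adj G) u v d → IsDist (contract H') u v d
  forward u v p d D = walkInH u v p d D , λ k w → proj₂ D k (toG w)

  backward : ∀ u v → P u v → ∀ d → IsDist (contract H') u v d → IsDist (Adj G) u v d
  backward u v p d (w , shortestInH) =
    toG w , lowerBound-from-minima (Walk (Adj G) u v) d
              (λ k wk minimal → shortestInH k (walkInH u v p k (wk , minimal)))
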